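{- Let $\mathtt{X} \in \{\mathtt{CS}, \mathtt{S}\}$, with $\mathcal{E}_{\mathtt{CS}} = \mathcal{E}_1 \cup \{\mathrm{CS},\mathrm{CSP1},\mathrm{CSP2},\mathrm{EL1}\}$ and $\mathcal{E}_{\mathtt{S}} = \mathcal{E}_1\cup\{\mathrm{S},\mathrm{SP1},\mathrm{SP2},\mathrm{EL1}\}$. Then for all closed $\mathrm{BCCSP}_{\|}$ terms $p,q$: $p\sim_{\mathtt{X}} q$ if and only if $\mathcal{E}_{\mathtt{X}}\vdash p\approx q$.
   Context: Let $\mathcal{A}$ be a finite non-empty set of actions and $\mathcal{V}$ a countably infinite set of variables. $\mathrm{BCCSP}_{\|}$ terms are generated by $t ::= \mathbf{0} \mid x \mid a.t \mid t+t \mid t \,\|\, t$ with $a\in\mathcal{A}$, $x \in \mathcal{V}$ ($ax$ means $a.x$; prefixing binds strongest, $+$ weakest). Closed terms are called processes. Transitions on processes: $a.p \xrightarrow{a} p$; if $p \xrightarrow{a} p'$ then $p+q \xrightarrow{a} p'$, $q+p \xrightarrow{a} p'$, $p\|q \xrightarrow{a} p'\|q$, $q \| p \xrightarrow{a} q \| p'$. $\mathtt{I}(p)=\{a \mid \exists p'.\, p \xrightarrow{a} p'\}$. A simulation is a relation $R$ on processes with: $pRq$ and $p\xrightarrow{a}p'$ imply $q\xrightarrow{a}q'$ and $p'Rq'$ for some $q'$. A completed simulation is a simulation $R$ such that $pRq$ and $\mathtt{I}(p)=\emptyset$ imply $\mathtt{I}(q)=\emptyset$. $p\sqsubseteq_{\mathtt{S}}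 q$ (resp. $p\sqsubseteq_{\mathtt{CS}} q$) iff $pRq$ for some simulation (resp. completed simulation) $R$; $\sim_{\mathtt{S}}$ and $\sim_{\mathtt{CS}}$ are the kernels $\sqsubseteq\cap\sqsubseteq^{ -1}$. $\mathcal{E}\vdash t\approx u$ means derivable in equational logic (reflexivity, symmetry, transitivity, substitution instances of axioms, closure under $a.\_$, $+$, $\|$). Axioms with concrete action names stand for all instances with actions from $\mathcal{A}$. $\mathcal{E}_1$: A0 $x+\mathbf{0}\approx x$; A1 $x+y\approx y+x$; A2 $(x+y)+z \approx x+(y+z)$; A3 $x+x\approx x$; P0 $x\|\mathbf{0}\approx x$; P1 $x\|y \approx y \| x$. CS: $a(bx+y+z)\approx a(bx+y+z)+a(bx+z)$. CSP1: $(ax+by+u)\|(cz+dw+v)\approx (ax+u)\|(cz+dw+v)+(by+u)\|(cz+dw+v)+(ax+by+u)\|(cz+v)+(ax+by+u)\|(dw+v)$. CSP2: $ax\|(by+cz+w)\approx a(x\|(by+cz+w))+ax\|(by+w)+ax\|(cz+w)$. EL1: $ax\|by\approx a(x\|by)+b(ax\|y)$. S: $a(x+y)\approx a(x+y)+ax$. SP1: $(x+y)\|(z+w)\approx x\|(z+w)+y\|(z+w)+(x+y)\|z+(x+y)\|w$. SP2: $ax\|(y+z)\approx a(x\|(y+z))+ax\|y+ax\|z$. -}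

module Defs where

open import Data.Nat using (ℕ; suc)
open import Data.Fin using (Fin)
open import Data.Product using (Σ; _×_; _,_; ∃)
open import Data.Empty using (⊥)
open import Relation.Binary.PropositionalEquality using (_≡_)

infixr 30 _∙_
infixl 20 _⊕_
infixl 25 _∥_

data Term (A : Set) : Set where
  𝟎   : Term A
  var : ℕ → Term A
  _∙_ : A → Term A → Term A
  _⊕_ : Term A → Term A → Term A
  _∥_ : Term A → Term A → Term A

module _ {A : Set} where

  data Closed : Term A → Set where
    c𝟎 : Closed 𝟎
    c∙ : ∀ {a t} → Closed t → Closed (a ∙ t)
    c⊕ : ∀ {t u} → Closed t → Closed u → Closed (t ⊕ u)
    c∥ : ∀ {t u} → Closed t → Closed u → Closed (t ∥ u)

  Subst : Set
  Subst = ℕ → Term A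

  _[_] : Term A → Subst → Term A
  𝟎 [ σ ] = 𝟎
  var x [ σ ] = σ x
  (a ∙ t) [ σ ] = a ∙ (t [ σ ])
  (t ⊕ u) [ σ ] = (t [ σ ]) ⊕ (u [ σ ])
  (t ∥ u) [ σ ] = (t [ σ ]) ∥ (u [ σ ])

  data _─[_]→_ : Term A → A → Term A → Set where
    pre  : ∀ {a p} → (a ∙ p) ─[ a ]→ p
    sumˡ : ∀ {a p p' q} → p ─[ a ]→ p' → (p ⊕ q) ─[ a ]→ p'
    sumʳ : ∀ {a p p' q} → p ─[ a ]→ p' → (q ⊕ p) ─[ a ]→ p'
    parˡ : ∀ {a p p' q} → p ─[ a ]→ p' → (p ∥ q) ─[ a ]→ (p' ∥ q)
    parʳ : ∀ {a p p' q} → p ─[ a ]→ p' → (q ∥ p) ─[ a ]→ (q ∥ p')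

  NoInit : Term A → Set
  NoInit p = ∀ a p' → p ─[ a ]→ p' → ⊥

  IsSimulation : (Term A → Term A → Set) → Set
  IsSimulation R = ∀ {p q a p'} → R p q → p ─[ a ]→ p' →
                   Σ (Term A) λ q' → (q ─[ a ]→ q') × R p' q'

  IsCompletedSimulation : (Term A → Term A → Set) → Set
  IsCompletedSimulation R =
    IsSimulation R × (∀ {p q} → R p q → NoInit p → NoInit q)

  _⊑S_ : Term A → Term A → Set₁
  p ⊑S q = Σ (Term A → Term A → Set) λ R → IsSimulation R × R p q

  _⊑CS_ : Term A → Term A → Set₁
  p ⊑CS q = Σ (Term A → Term A → Set) λ R → IsCompletedSimulation R × R p q

  _∼S_ : Term A → Term A → Set₁
  p ∼S q = (p ⊑S q) × (q ⊑S p)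

  _∼CS_ : Term A → Term A → Set₁
  p ∼CS q = (p ⊑CS q) × (q ⊑CS p)

  data _⊢_≈_ (Ax : Term A → Term A → Set) : Term A → Term A → Set where
    refl  : ∀ {t} → Ax ⊢ t ≈ t
    sym   : ∀ {t u} → Ax ⊢ t ≈ u → Ax ⊢ u ≈ t
    trans : ∀ {t u v} → Ax ⊢ t ≈ u → Ax ⊢ u ≈ v → Ax ⊢ t ≈ v
    inst  : ∀ {t u} → Ax t u → (σ : Subst) → Ax ⊢ (t [ σ ]) ≈ (u [ σ ])
    ctx∙  : ∀ {t u} (a : A) → Ax ⊢ t ≈ u → Ax ⊢ (a ∙ t) ≈ (a ∙ u)
    ctx⊕  : ∀ {t t' u u'} → Ax ⊢ t ≈ t' → Ax ⊢ u ≈ u' → Ax ⊢ (t ⊕ u) ≈ (t' ⊕ u')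
    ctx∥  : ∀ {t t' u u'} → Ax ⊢ t ≈ t' → Ax ⊢ u ≈ u' → Ax ⊢ (t ∥ u) ≈ (t' ∥ u')

  private
    x y z w u v : Term A
    x = var 0
    y = var 1
    z = var 2
    w = var 3
    u = var 4
    v = var 5

  data E₁ : Term A → Term A → Set where
    A0 : E₁ (x ⊕ 𝟎) x
    A1 : E₁ (x ⊕ y) (y ⊕ x)
    A2 : E₁ ((x ⊕ y) ⊕ z) (x ⊕ (y ⊕ z))
    A3 : E₁ (x ⊕ x) x
    P0 : E₁ (x ∥ 𝟎) x
    P1 : E₁ (x ∥ y) (y ∥ x)

  data E-CS : Term A → Term A → Set where
    e₁   : ∀ {t t'} → E₁ t t' → E-CS t t'
    CS   : ∀ a b → E-CS (a ∙ (b ∙ x ⊕ y ⊕ z))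
                        (a ∙ (b ∙ x ⊕ y ⊕ z) ⊕ a ∙ (b ∙ x ⊕ z))
    CSP1 : ∀ a b c d →
      E-CS ((a ∙ x ⊕ b ∙ y ⊕ u) ∥ (c ∙ z ⊕ d ∙ w ⊕ v))
           ((a ∙ x ⊕ u) ∥ (c ∙ z ⊕ d ∙ w ⊕ v)
            ⊕ (b ∙ y ⊕ u) ∥ (c ∙ z ⊕ d ∙ w ⊕ v)
            ⊕ (a ∙ x ⊕ b ∙ y ⊕ u) ∥ (c ∙ z ⊕ v)
            ⊕ (a ∙ x ⊕ b ∙ y ⊕ u) ∥ (d ∙ w ⊕ v))
    CSP2 : ∀ a b c →
      E-CS (a ∙ x ∥ (b ∙ y ⊕ c ∙ z ⊕ w))
           (a ∙ (x ∥ (b ∙ y ⊕ c ∙ z ⊕ w))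
            ⊕ a ∙ x ∥ (b ∙ y ⊕ w)
            ⊕ a ∙ x ∥ (c ∙ z ⊕ w))
    EL1  : ∀ a b → E-CS (a ∙ x ∥ b ∙ y) (a ∙ (x ∥ b ∙ y) ⊕ b ∙ (a ∙ x ∥ y))

  data E-S : Term A → Term A → Set where
    e₁  : ∀ {t t'} → E₁ t t' → E-S t t'
    S   : ∀ a → E-S (a ∙ (x ⊕ y)) (a ∙ (x ⊕ y) ⊕ a ∙ x)
    SP1 : E-S ((x ⊕ y) ∥ (z ⊕ w))
              (x ∥ (z ⊕ w) ⊕ y ∥ (z ⊕ w) ⊕ (x ⊕ y) ∥ z ⊕ (x ⊕ y) ∥ w)
    SP2 : ∀ a → E-S (a ∙ x ∥ (y ⊕ z))
                    (a ∙ (x ∥ (y ⊕ z)) ⊕ a ∙ x ∥ y ⊕ a ∙ x ∥ z)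
    EL1 : ∀ a b → E-S (a ∙ x ∥ b ∙ y) (a ∙ (x ∥ b ∙ y) ⊕ b ∙ (a ∙ x ∥ y))

data Sem : Set where
  CS S : Sem

module _ {A : Set} where
  _∼[_]_ : Term A → Sem → Term A → Set₁
  p ∼[ CS ] q = p ∼CS q
  p ∼[ S ] q = p ∼S q

  𝓔 : Sem → Term A → Term A → Set
  𝓔 CS = E-CS
  𝓔 S = E-S

-- Soundness: every axiom relates terms with matching transitions, and (completed)
-- similarity is a precongruence for prefixing, + and ∥.  Processes are finite and
-- every transition decreases the size of a term, so (completed) similarity has an
-- inductive characterisation, which makes these facts structural recursions.
--
-- Completeness: with EL1 and the expansion laws CSP1/CSP2 (in 𝓔_S consequences of
-- SP1/SP2), every closed term is provably equal to a sum of prefixed normal forms.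
-- If p ≲ q for normal forms then each summand a.t of p is absorbed by a summand a.q′
-- of q matching its move, a.q′ ≈ a.q′ + a.t (by S, resp. by CS, where the completion
-- clause handles t = 0); hence q ≈ q + p, and mutual similarity gives p ≈ q.
module Submission where

open import Defs
open import Data.List using (List; []; _∷_)
open import Data.Nat using (ℕ; zero; suc; _+_; _<_; s≤s; z<s)
open import Data.Nat.Properties using (<-≤-trans; m≤m+n; m≤n+m; m<n+m; +-monoˡ-<; +-monoʳ-<; n<1+n)
open import Data.Nat.Induction using (<-wellFounded)
open import Induction.WellFounded using (Acc; acc)
open import Data.Product using (∃-syntax; _×_; _,_; swap; map; zip)
open import Data.Product.Function.NonDependent.Propositional using (_×-⇔_)
open import Data.Unit using (⊤; tt)
open import Data.Empty using (⊥-elim)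
open import Data.Fin using (Fin)
open import Function.Base using (_∘_)
open import Function.Bundles using (_⇔_; mk⇔; Equivalence)
open import Algebra.Bundles using (IdempotentCommutativeMonoid)
open import Algebra.Lattice.Bundles using (Semilattice)
open import Relation.Binary.Bundles using (Setoid)
open import Relation.Binary.Lattice.Bundles using (JoinSemilattice)
import Algebra.Properties.IdempotentCommutativeMonoid as ICMProperties
import Algebra.Lattice.Properties.Semilattice as SemilatticeProperties
import Relation.Binary.Reasoning.Setoid as SetoidReasoning

private variable
  A : Set
  k : Sem
  a b c d : A
  p q r t u w v p′ q′ U V : Term A
  R : Term A → Term A → Set

Transfer : (Term A → Term A → Set) → Term A → Term A → Set
Transfer R p q = ∀ {a p′} → p ─[ a ]→ p′ → ∃[ q′ ] (q ─[ a ]→ q′ × R p′ q′)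

Completion : Sem → Term A → Term A → Set
Completion S  p q = ⊤
Completion CS p q = NoInit p → NoInit q

completion-⊆ : ∀ k → (∀ {a q′} → q ─[ a ]→ q′ → ∃[ p′ ] p ─[ a ]→ p′) → Completion k p q
completion-⊆ S  _ = tt
completion-⊆ CS moves stuck a q′ t with moves t
... | p′ , t′ = stuck a p′ t′

completion-move : ∀ k → p ─[ a ]→ p′ → Completion k p q
completion-move S  _ = tt
completion-move CS t stuck = ⊥-elim (stuck _ _ t)

completion-trans : ∀ k → Completion k p q → Completion k q r → Completion k p r
completion-trans S  _ _ = tt
completion-trans CS c d = d ∘ c

completion-⊕ : ∀ k → Completion k p p′ → Completion k q q′ → Completion k (p ⊕ q) (p′ ⊕ q′)
completion-⊕ S  _ _ = tt
completion-⊕ CS c d stuck a _ (sumˡ t) = c (λ b _ s → stuck b _ (sumˡ s)) a _ t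
completion-⊕ CS c d stuck a _ (sumʳ t) = d (λ b _ s → stuck b _ (sumʳ s)) a _ t

completion-∥-swap : ∀ k → Completion k p p′ → Completion k q q′ → Completion k (p ∥ q) (q′ ∥ p′)
completion-∥-swap S  _ _ = tt
completion-∥-swap CS c d stuck a _ (parˡ t) = d (λ b _ s → stuck b _ (parʳ s)) a _ t
completion-∥-swap CS c d stuck a _ (parʳ t) = c (λ b _ s → stuck b _ (parˡ s)) a _ t

infix 4 _≲[_]_ _≃[_]_

-- Inductive, hence well founded: it agrees with the existence of a (completed)
-- simulation only because transitions decrease size (see simulation⇒≲).
data _≲[_]_ {A : Set} : Term A → Sem → Term A → Set where
  sim : Transfer _≲[ k ]_ p q → Completion k p q → p ≲[ k ] q

_≃[_]_ : Term A → Sem → Term A → Set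
p ≃[ k ] q = p ≲[ k ] q × q ≲[ k ] p

≲-transfer : p ≲[ k ] q → Transfer _≲[ k ]_ p q
≲-transfer (sim f _) = f

≲-completion : p ≲[ k ] q → Completion k p q
≲-completion (sim _ c) = c

∙-mono : p ≲[ k ] q → a ∙ p ≲[ k ] a ∙ q
∙-mono {k = k} s = sim (λ { pre → _ , pre , s }) (completion-move k pre)

⊕-mono : p ≲[ k ] p′ → q ≲[ k ] q′ → p ⊕ q ≲[ k ] p′ ⊕ q′
⊕-mono {k = k} (sim f c) (sim g d) = sim transfer (completion-⊕ k c d)
  where
  transfer : Transfer _ _ _
  transfer (sumˡ t) with f t
  ... | _ , t′ , s = _ , sumˡ t′ , s
  transfer (sumʳ t) with g t
  ... | _ , t′ , s = _ , sumʳ t′ , s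

∥-swap : p ≲[ k ] p′ → q ≲[ k ] q′ → p ∥ q ≲[ k ] q′ ∥ p′
∥-swap-transfer : p ≲[ k ] p′ → q ≲[ k ] q′ → Transfer _≲[ k ]_ (p ∥ q) (q′ ∥ p′)

∥-swap {k = k} s₁ s₂ =
  sim (∥-swap-transfer s₁ s₂) (completion-∥-swap k (≲-completion s₁) (≲-completion s₂))

∥-swap-transfer (sim f _) s₂ (parˡ t) with f t
... | _ , t′ , s = _ , parʳ t′ , ∥-swap s s₂
∥-swap-transfer s₁ (sim g _) (parʳ t) with g t
... | _ , t′ , s = _ , parˡ t′ , ∥-swap s₁ s

≲-trans : p ≲[ k ] q → q ≲[ k ] r → p ≲[ k ] r
≲-trans {k = k} (sim f c) (sim g d) = sim transfer (completion-trans k c d)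
  where
  transfer : Transfer _ _ _
  transfer t with f t
  ... | _ , t′ , s with g t′
  ... | _ , t″ , s′ = _ , t″ , ≲-trans s s′

≲-refl : ∀ k (p : Term A) → p ≲[ k ] p
≲-refl k 𝟎       = sim (λ ()) (completion-⊆ k (λ t → _ , t))
≲-refl k (var _) = sim (λ ()) (completion-⊆ k (λ t → _ , t))
≲-refl k (a ∙ p) = ∙-mono (≲-refl k p)
≲-refl k (p ⊕ q) = ⊕-mono (≲-refl k p) (≲-refl k q)
≲-refl k (p ∥ q) = ≲-trans (∥-swap (≲-refl k p) (≲-refl k q)) (∥-swap (≲-refl k q) (≲-refl k p))

∥-mono : p ≲[ k ] p′ → q ≲[ k ] q′ → p ∥ q ≲[ k ] p′ ∥ q′
∥-mono {k = k} s₁ s₂ = ≲-trans (∥-swap s₁ s₂) (∥-swap (≲-refl k _) (≲-refl k _))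

⊕-lub : p ≲[ k ] r → q ≲[ k ] r → p ⊕ q ≲[ k ] r
⊕-lub {k = k} (sim f c) (sim g _) =
  sim (λ { (sumˡ t) → f t ; (sumʳ t) → g t })
      (completion-trans k (completion-⊆ k (λ t → _ , sumˡ t)) c)

∥𝟎-≲ : p ≲[ k ] q → p ∥ 𝟎 ≲[ k ] q
∥𝟎-≲ {k = k} (sim f c) = sim transfer (completion-trans k (completion-⊆ k (λ t → _ , parˡ t)) c)
  where
  transfer : Transfer _ _ _
  transfer (parˡ t) with f t
  ... | _ , t′ , s = _ , t′ , ∥𝟎-≲ s

≲-∥𝟎 : p ≲[ k ] q → p ≲[ k ] q ∥ 𝟎
≲-∥𝟎 {k = k} (sim f c) = sim transfer (completion-trans k c (completion-⊆ k λ { (parˡ t) → _ , t }))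
  where
  transfer : Transfer _ _ _
  transfer t with f t
  ... | _ , t′ , s = _ , parˡ t′ , ≲-∥𝟎 s

≃-sym : p ≃[ k ] q → q ≃[ k ] p
≃-sym = swap

≃-trans : p ≃[ k ] q → q ≃[ k ] r → p ≃[ k ] r
≃-trans (s₁ , s₁′) (s₂ , s₂′) = ≲-trans s₁ s₂ , ≲-trans s₂′ s₁′

size : Term A → ℕ
size 𝟎       = 0
size (var _) = 0
size (_ ∙ p) = suc (size p)
size (p ⊕ q) = size p + size q
size (p ∥ q) = size p + size q

size-step : p ─[ a ]→ p′ → size p′ < size p
size-step pre = n<1+n _
size-step {p = p ⊕ q} (sumˡ t) = <-≤-trans (size-step t) (m≤m+n (size p) (size q))
size-step {p = q ⊕ p} (sumʳ t) = <-≤-trans (size-step t) (m≤n+m (size p) (size q))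
size-step {p = p ∥ q} (parˡ t) = +-monoˡ-< (size q) (size-step t)
size-step {p = q ∥ p} (parʳ t) = +-monoʳ-< (size q) (size-step t)

simulation⇒≲ : IsSimulation R → (∀ {p q} → R p q → Completion k p q) → R p q → p ≲[ k ] q
simulation⇒≲ {R = R} {k = k} isSim complete = go (<-wellFounded _)
  where
  go : ∀ {p q} → Acc _<_ (size p) → R p q → p ≲[ k ] q
  go (acc rec) r = sim transfer (complete r)
    where
    transfer : Transfer _ _ _
    transfer t with isSim r t
    ... | _ , t′ , r′ = _ , t′ , go (rec (size-step t)) r′

≲-isSimulation : IsSimulation {A = A} _≲[ k ]_
≲-isSimulation (sim f _) = f

⊑S⇔≲ : p ⊑S q ⇔ p ≲[ S ] q
⊑S⇔≲ = mk⇔ (λ (_ , isSim , r) → simulation⇒≲ isSim (λ _ → tt) r)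
           (λ s → _≲[ S ]_ , (λ {_ _ _ _} → ≲-isSimulation) , s)

⊑CS⇔≲ : p ⊑CS q ⇔ p ≲[ CS ] q
⊑CS⇔≲ = mk⇔ (λ (_ , (isSim , complete) , r) → simulation⇒≲ isSim complete r)
            (λ s → _≲[ CS ]_ , ((λ {_ _ _ _} → ≲-isSimulation) , λ {_ _} → ≲-completion) , s)

∼⇔≃ : ∀ k → p ∼[ k ] q ⇔ p ≃[ k ] q
∼⇔≃ S  = ⊑S⇔≲ ×-⇔ ⊑S⇔≲
∼⇔≃ CS = ⊑CS⇔≲ ×-⇔ ⊑CS⇔≲

≲-by-moves : (∀ {a p′} → p ─[ a ]→ p′ → q ─[ a ]→ p′) → Completion k p q → p ≲[ k ] q
≲-by-moves {k = k} moves = sim (λ t → _ , moves t , ≲-refl k _)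

≃-by-moves : (∀ {a p′} → p ─[ a ]→ p′ → q ─[ a ]→ p′) → (∀ {a q′} → q ─[ a ]→ q′ → p ─[ a ]→ q′) →
             p ≃[ k ] q
≃-by-moves {k = k} moves moves′ =
  ≲-by-moves moves (completion-⊆ k (λ t → _ , moves′ t)) ,
  ≲-by-moves moves′ (completion-⊆ k (λ t → _ , moves t))

⊕-upperˡ : p ≲[ S ] p ⊕ q
⊕-upperˡ = ≲-by-moves sumˡ tt

⊕-upperʳ : q ≲[ S ] p ⊕ q
⊕-upperʳ = ≲-by-moves sumʳ tt

∙⊕-insertʳ : a ∙ p ⊕ r ≲[ k ] (a ∙ p ⊕ q) ⊕ r
∙⊕-insertʳ {k = k} =
  ≲-by-moves (λ { (sumˡ t) → sumˡ (sumˡ t) ; (sumʳ t) → sumʳ t }) (completion-move k (sumˡ pre))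

∙⊕-insertˡ : a ∙ p ⊕ r ≲[ k ] (q ⊕ a ∙ p) ⊕ r
∙⊕-insertˡ {k = k} =
  ≲-by-moves (λ { (sumˡ t) → sumˡ (sumʳ t) ; (sumʳ t) → sumʳ t }) (completion-move k (sumˡ pre))

E₁-sound : E₁ t u → ∀ σ → t [ σ ] ≃[ k ] u [ σ ]
E₁-sound A0 σ = ≃-by-moves (λ { (sumˡ t) → t ; (sumʳ ()) }) sumˡ
E₁-sound A1 σ = ≃-by-moves (λ { (sumˡ t) → sumʳ t ; (sumʳ t) → sumˡ t })
                           (λ { (sumˡ t) → sumʳ t ; (sumʳ t) → sumˡ t })
E₁-sound A2 σ = ≃-by-moves (λ { (sumˡ (sumˡ t)) → sumˡ t
                              ; (sumˡ (sumʳ t)) → sumʳ (sumˡ t)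
                              ; (sumʳ t)        → sumʳ (sumʳ t) })
                           (λ { (sumˡ t)        → sumˡ (sumˡ t)
                              ; (sumʳ (sumˡ t)) → sumˡ (sumʳ t)
                              ; (sumʳ (sumʳ t)) → sumʳ t })
E₁-sound A3 σ = ≃-by-moves (λ { (sumˡ t) → t ; (sumʳ t) → t }) sumˡ
E₁-sound {k = k} P0 σ = ∥𝟎-≲ (≲-refl k _) , ≲-∥𝟎 (≲-refl k _)
E₁-sound {k = k} P1 σ = ∥-swap (≲-refl k _) (≲-refl k _) , ∥-swap (≲-refl k _) (≲-refl k _)

EL1-sound : a ∙ p ∥ b ∙ q ≃[ k ] a ∙ (p ∥ b ∙ q) ⊕ b ∙ (a ∙ p ∥ q)
EL1-sound = ≃-by-moves (λ { (parˡ pre) → sumˡ pre ; (parʳ pre) → sumʳ pre })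
                       (λ { (sumˡ pre) → parˡ pre ; (sumʳ pre) → parʳ pre })

E-S-sound : E-S t u → ∀ σ → t [ σ ] ≃[ S ] u [ σ ]
E-S-sound (e₁ ax) σ = E₁-sound ax σ
E-S-sound (S a) σ = ≲-by-moves sumˡ tt , ⊕-lub (≲-refl S _) (∙-mono ⊕-upperˡ)
E-S-sound SP1 σ =
  ≲-by-moves (λ { (parˡ (sumˡ t)) → sumˡ (sumˡ (sumˡ (parˡ t)))
                ; (parˡ (sumʳ t)) → sumˡ (sumˡ (sumʳ (parˡ t)))
                ; (parʳ (sumˡ t)) → sumˡ (sumʳ (parʳ t))
                ; (parʳ (sumʳ t)) → sumʳ (parʳ t) }) tt ,
  ⊕-lub (⊕-lub (⊕-lub (∥-mono ⊕-upperˡ (≲-refl S _)) (∥-mono ⊕-upperʳ (≲-refl S _)))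
               (∥-mono (≲-refl S _) ⊕-upperˡ))
        (∥-mono (≲-refl S _) ⊕-upperʳ)
E-S-sound (SP2 a) σ =
  ≲-by-moves (λ { (parˡ pre) → sumˡ (sumˡ pre)
                ; (parʳ (sumˡ t)) → sumˡ (sumʳ (parʳ t))
                ; (parʳ (sumʳ t)) → sumʳ (parʳ t) }) tt ,
  ⊕-lub (⊕-lub (≲-by-moves (λ { pre → parˡ pre }) tt) (∥-mono (≲-refl S _) ⊕-upperˡ))
        (∥-mono (≲-refl S _) ⊕-upperʳ)
E-S-sound (EL1 a b) σ = EL1-sound

E-CS-sound : E-CS t u → ∀ σ → t [ σ ] ≃[ CS ] u [ σ ]
E-CS-sound (e₁ ax) σ = E₁-sound ax σ
E-CS-sound (CS a b) σ = ≲-by-moves sumˡ (completion-move CS pre) , ⊕-lub (≲-refl CS _) (∙-mono ∙⊕-insertʳ)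
E-CS-sound (CSP1 a b c d) σ =
  ≲-by-moves (λ { (parˡ (sumˡ (sumˡ t))) → sumˡ (sumˡ (sumˡ (parˡ (sumˡ t))))
                ; (parˡ (sumˡ (sumʳ t))) → sumˡ (sumˡ (sumʳ (parˡ (sumˡ t))))
                ; (parˡ (sumʳ t))        → sumˡ (sumˡ (sumˡ (parˡ (sumʳ t))))
                ; (parʳ (sumˡ (sumˡ t))) → sumˡ (sumʳ (parʳ (sumˡ t)))
                ; (parʳ (sumˡ (sumʳ t))) → sumʳ (parʳ (sumˡ t))
                ; (parʳ (sumʳ t))        → sumˡ (sumʳ (parʳ (sumʳ t))) })
             (completion-move CS (parˡ (sumˡ (sumˡ pre)))) ,
  ⊕-lub (⊕-lub (⊕-lub (∥-mono ∙⊕-insertʳ (≲-refl CS _)) (∥-mono ∙⊕-insertˡ (≲-refl CS _)))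
               (∥-mono (≲-refl CS _) ∙⊕-insertʳ))
        (∥-mono (≲-refl CS _) ∙⊕-insertˡ)
E-CS-sound (CSP2 a b c) σ =
  ≲-by-moves (λ { (parˡ pre)              → sumˡ (sumˡ pre)
                ; (parʳ (sumˡ (sumˡ t))) → sumˡ (sumʳ (parʳ (sumˡ t)))
                ; (parʳ (sumˡ (sumʳ t))) → sumʳ (parʳ (sumˡ t))
                ; (parʳ (sumʳ t))        → sumʳ (parʳ (sumʳ t)) })
             (completion-move CS (parˡ pre)) ,
  ⊕-lub (⊕-lub (≲-by-moves (λ { pre → parˡ pre }) (completion-move CS pre))
               (∥-mono (≲-refl CS _) ∙⊕-insertʳ))
        (∥-mono (≲-refl CS _) ∙⊕-insertˡ)
E-CS-sound (EL1 a b) σ = EL1-sound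

axiom-sound : ∀ k → 𝓔 k t u → ∀ σ → t [ σ ] ≃[ k ] u [ σ ]
axiom-sound S  = E-S-sound
axiom-sound CS = E-CS-sound

sound : ∀ k → 𝓔 k ⊢ t ≈ u → t ≃[ k ] u
sound k refl        = ≲-refl k _ , ≲-refl k _
sound k (sym e)     = ≃-sym (sound k e)
sound k (trans e f) = ≃-trans (sound k e) (sound k f)
sound k (inst ax σ) = axiom-sound k ax σ
sound k (ctx∙ a e)  = map ∙-mono ∙-mono (sound k e)
sound k (ctx⊕ e f)  = zip ⊕-mono ⊕-mono (sound k e) (sound k f)
sound k (ctx∥ e f)  = zip ∥-mono ∥-mono (sound k e) (sound k f)

-- Instantiates var 0, var 1, … (x, y, z, w, u, v in Defs) by the listed terms.
⟨_⟩ : List (Term A) → Subst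
⟨ [] ⟩     _       = 𝟎
⟨ t ∷ _ ⟩  zero    = t
⟨ _ ∷ ts ⟩ (suc i) = ⟨ ts ⟩ i

E₁⊆𝓔 : ∀ k → E₁ t u → 𝓔 k t u
E₁⊆𝓔 S  = e₁
E₁⊆𝓔 CS = e₁

EL1-law : ∀ k {a b : A} {x y : Term A} →
  𝓔 k ⊢ (a ∙ x ∥ b ∙ y) ≈ (a ∙ (x ∥ b ∙ y) ⊕ b ∙ (a ∙ x ∥ y))
EL1-law S  {a} {b} {x} {y} = inst (EL1 a b) ⟨ x ∷ y ∷ [] ⟩
EL1-law CS {a} {b} {x} {y} = inst (EL1 a b) ⟨ x ∷ y ∷ [] ⟩

infix 4 _≼[_]_

_≼[_]_ : Term A → Sem → Term A → Set
p ≼[ k ] q = 𝓔 k ⊢ q ≈ (q ⊕ p)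

module Equational {A : Set} (k : Sem) where

  ⊕-identityʳ : ∀ (p : Term A) → 𝓔 k ⊢ (p ⊕ 𝟎) ≈ p
  ⊕-identityʳ p = inst (E₁⊆𝓔 k A0) ⟨ p ∷ [] ⟩

  ⊕-comm : ∀ (p q : Term A) → 𝓔 k ⊢ (p ⊕ q) ≈ (q ⊕ p)
  ⊕-comm p q = inst (E₁⊆𝓔 k A1) ⟨ p ∷ q ∷ [] ⟩

  ⊕-assoc : ∀ (p q r : Term A) → 𝓔 k ⊢ ((p ⊕ q) ⊕ r) ≈ (p ⊕ (q ⊕ r))
  ⊕-assoc p q r = inst (E₁⊆𝓔 k A2) ⟨ p ∷ q ∷ r ∷ [] ⟩

  ⊕-idem : ∀ (p : Term A) → 𝓔 k ⊢ (p ⊕ p) ≈ p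
  ⊕-idem p = inst (E₁⊆𝓔 k A3) ⟨ p ∷ [] ⟩

  ∥-identityʳ : ∀ (p : Term A) → 𝓔 k ⊢ p ∥ 𝟎 ≈ p
  ∥-identityʳ p = inst (E₁⊆𝓔 k P0) ⟨ p ∷ [] ⟩

  ∥-comm : ∀ (p q : Term A) → 𝓔 k ⊢ p ∥ q ≈ q ∥ p
  ∥-comm p q = inst (E₁⊆𝓔 k P1) ⟨ p ∷ q ∷ [] ⟩

  ≈-setoid : Setoid _ _
  ≈-setoid = record
    { Carrier       = Term A
    ; _≈_           = 𝓔 k ⊢_≈_
    ; isEquivalence = record { refl = refl ; sym = sym ; trans = trans }
    }

  ⊕-idempotentCommutativeMonoid : IdempotentCommutativeMonoid _ _
  ⊕-idempotentCommutativeMonoid = record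
    { Carrier = Term A
    ; _≈_     = 𝓔 k ⊢_≈_
    ; _∙_     = _⊕_
    ; ε       = 𝟎
    ; isIdempotentCommutativeMonoid = record
      { isCommutativeMonoid = record
        { isMonoid = record
          { isSemigroup = record
            { isMagma = record
              { isEquivalence = Setoid.isEquivalence ≈-setoid
              ; ∙-cong        = ctx⊕
              }
            ; assoc = ⊕-assoc
            }
          ; identity = (λ p → trans (⊕-comm 𝟎 p) (⊕-identityʳ p)) , ⊕-identityʳ
          }
        ; comm = ⊕-comm
        }
      ; idem = ⊕-idem
      }
    }

  open IdempotentCommutativeMonoid ⊕-idempotentCommutativeMonoid public
    using () renaming (identityˡ to ⊕-identityˡ)
  open ICMProperties ⊕-idempotentCommutativeMonoid public
    using () renaming (∙-distrʳ-∙ to ⊕-distribʳ-⊕)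
  open SetoidReasoning ≈-setoid public

  ⊕-semilattice : Semilattice _ _
  ⊕-semilattice = record
    { isSemilattice = IdempotentCommutativeMonoid.isCommutativeBand ⊕-idempotentCommutativeMonoid }

  -- Its order is, definitionally, _≼[ k ]_.
  ≼-joinSemilattice : JoinSemilattice _ _ _
  ≼-joinSemilattice = SemilatticeProperties.∧-orderTheoreticJoinSemilattice ⊕-semilattice

  open JoinSemilattice ≼-joinSemilattice public using ()
    renaming ( refl to ≼-refl; trans to ≼-trans; antisym to ≼-antisym
             ; x≤x∨y to ≼-upperˡ; y≤x∨y to ≼-upperʳ; ∨-least to ≼-lub )

  𝟎≼ : ∀ (p : Term A) → 𝟎 ≼[ k ] p
  𝟎≼ p = sym (⊕-identityʳ p)

data NF {A : Set} : Term A → Set where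
  nil  : NF 𝟎
  cons : ∀ a {t u} → NF t → NF u → NF (a ∙ t ⊕ u)

NF-step : NF p → p ─[ a ]→ p′ → NF p′
NF-step (cons _ nt _) (sumˡ pre) = nt
NF-step (cons _ _ nu) (sumʳ t)   = NF-step nu t

-- In 𝓔_S, distributing the common rest over the two prefixed summands turns CSP1 and
-- CSP2 into instances of SP1 and SP2.
CSP1-law : ∀ k {a b c d : A} {x y z w u v : Term A} →
  𝓔 k ⊢ ((a ∙ x ⊕ b ∙ y ⊕ u) ∥ (c ∙ z ⊕ d ∙ w ⊕ v))
      ≈ ((a ∙ x ⊕ u) ∥ (c ∙ z ⊕ d ∙ w ⊕ v)
         ⊕ (b ∙ y ⊕ u) ∥ (c ∙ z ⊕ d ∙ w ⊕ v)
         ⊕ (a ∙ x ⊕ b ∙ y ⊕ u) ∥ (c ∙ z ⊕ v)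
         ⊕ (a ∙ x ⊕ b ∙ y ⊕ u) ∥ (d ∙ w ⊕ v))
CSP1-law CS {a} {b} {c} {d} {x} {y} {z} {w} {u} {v} =
  inst (CSP1 a b c d) ⟨ x ∷ y ∷ z ∷ w ∷ u ∷ v ∷ [] ⟩
CSP1-law S {a} {b} {c} {d} {x} {y} {z} {w} {u} {v} = begin
  P ∥ Q                                              ≈⟨ ctx∥ (⊕-distribʳ-⊕ u _ _) (⊕-distribʳ-⊕ v _ _) ⟩
  (P₁ ⊕ P₂) ∥ (Q₁ ⊕ Q₂)                              ≈⟨ inst SP1 ⟨ P₁ ∷ P₂ ∷ Q₁ ∷ Q₂ ∷ [] ⟩ ⟩
  P₁ ∥ (Q₁ ⊕ Q₂) ⊕ P₂ ∥ (Q₁ ⊕ Q₂) ⊕ (P₁ ⊕ P₂) ∥ Q₁ ⊕ (P₁ ⊕ P₂) ∥ Q₂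
    ≈⟨ ctx⊕ (ctx⊕ (ctx⊕ (ctx∥ refl Q≈) (ctx∥ refl Q≈)) (ctx∥ P≈ refl)) (ctx∥ P≈ refl) ⟩
  P₁ ∥ Q ⊕ P₂ ∥ Q ⊕ P ∥ Q₁ ⊕ P ∥ Q₂                  ∎
  where
  open Equational S
  P = a ∙ x ⊕ b ∙ y ⊕ u
  Q = c ∙ z ⊕ d ∙ w ⊕ v
  P₁ = a ∙ x ⊕ u
  P₂ = b ∙ y ⊕ u
  Q₁ = c ∙ z ⊕ v
  Q₂ = d ∙ w ⊕ v
  P≈ : 𝓔 S ⊢ (P₁ ⊕ P₂) ≈ P
  P≈ = sym (⊕-distribʳ-⊕ u _ _)
  Q≈ : 𝓔 S ⊢ (Q₁ ⊕ Q₂) ≈ Q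
  Q≈ = sym (⊕-distribʳ-⊕ v _ _)

CSP2-law : ∀ k {a b c : A} {x y z w : Term A} →
  𝓔 k ⊢ (a ∙ x ∥ (b ∙ y ⊕ c ∙ z ⊕ w))
      ≈ (a ∙ (x ∥ (b ∙ y ⊕ c ∙ z ⊕ w)) ⊕ a ∙ x ∥ (b ∙ y ⊕ w) ⊕ a ∙ x ∥ (c ∙ z ⊕ w))
CSP2-law CS {a} {b} {c} {x} {y} {z} {w} = inst (CSP2 a b c) ⟨ x ∷ y ∷ z ∷ w ∷ [] ⟩
CSP2-law S {a} {b} {c} {x} {y} {z} {w} = begin
  a ∙ x ∥ Q                                       ≈⟨ ctx∥ refl (sym Q≈) ⟩
  a ∙ x ∥ (Q₁ ⊕ Q₂)                               ≈⟨ inst (SP2 a) ⟨ x ∷ Q₁ ∷ Q₂ ∷ [] ⟩ ⟩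
  a ∙ (x ∥ (Q₁ ⊕ Q₂)) ⊕ a ∙ x ∥ Q₁ ⊕ a ∙ x ∥ Q₂  ≈⟨ ctx⊕ (ctx⊕ (ctx∙ a (ctx∥ refl Q≈)) refl) refl ⟩
  a ∙ (x ∥ Q) ⊕ a ∙ x ∥ Q₁ ⊕ a ∙ x ∥ Q₂          ∎
  where
  open Equational S
  Q = b ∙ y ⊕ c ∙ z ⊕ w
  Q₁ = b ∙ y ⊕ w
  Q₂ = c ∙ z ⊕ w
  Q≈ : 𝓔 S ⊢ (Q₁ ⊕ Q₂) ≈ Q
  Q≈ = sym (⊕-distribʳ-⊕ w _ _)

∙-mono-≼S : ∀ a → t ≼[ S ] q → a ∙ t ≼[ S ] a ∙ q
∙-mono-≼S {t = t} {q = q} a t≼q = begin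
  a ∙ q                       ≈⟨ ctx∙ a q≈ ⟩
  a ∙ (t ⊕ q)                 ≈⟨ inst (S a) ⟨ t ∷ q ∷ [] ⟩ ⟩
  a ∙ (t ⊕ q) ⊕ a ∙ t         ≈⟨ ctx⊕ (ctx∙ a (sym q≈)) refl ⟩
  a ∙ q ⊕ a ∙ t               ∎
  where
  open Equational S
  q≈ : 𝓔 S ⊢ q ≈ (t ⊕ q)
  q≈ = trans t≼q (⊕-comm q t)

-- Axiom CS needs a prefixed summand b ∙ t of the absorbed term; if there is none,
-- the completion clause forces q = 𝟎 as well.
∙-mono-≼CS : ∀ a → NF t → NF q → Completion CS t q → t ≼[ CS ] q → a ∙ t ≼[ CS ] a ∙ q
∙-mono-≼CS a nil nil _ _ = Equational.≼-refl CS
∙-mono-≼CS a nil (cons _ _ _) completion _ = ⊥-elim (completion (λ _ _ ()) _ _ (sumˡ pre))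
∙-mono-≼CS {q = q} a (cons b {t} {U} _ _) _ _ t≼q = begin
  a ∙ q                                       ≈⟨ ctx∙ a q≈ ⟩
  a ∙ (b ∙ t ⊕ q ⊕ U)                         ≈⟨ inst (CS a b) ⟨ t ∷ q ∷ U ∷ [] ⟩ ⟩
  a ∙ (b ∙ t ⊕ q ⊕ U) ⊕ a ∙ (b ∙ t ⊕ U)       ≈⟨ ctx⊕ (ctx∙ a (sym q≈)) refl ⟩
  a ∙ q ⊕ a ∙ (b ∙ t ⊕ U)                     ∎
  where
  open Equational CS
  q≈ : 𝓔 CS ⊢ q ≈ (b ∙ t ⊕ q ⊕ U)
  q≈ = begin
    q                  ≈⟨ t≼q ⟩
    q ⊕ (b ∙ t ⊕ U)    ≈⟨ ⊕-assoc _ _ _ ⟨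
    q ⊕ b ∙ t ⊕ U      ≈⟨ ctx⊕ (⊕-comm _ _) refl ⟩
    b ∙ t ⊕ q ⊕ U      ∎

∙-mono-≼ : ∀ k a → NF t → NF q → Completion k t q → t ≼[ k ] q → a ∙ t ≼[ k ] a ∙ q
∙-mono-≼ S  a _ _ _ = ∙-mono-≼S a
∙-mono-≼ CS a       = ∙-mono-≼CS a

weight : NF p → ℕ
weight nil            = 0
weight (cons _ nt nu) = suc (weight nt + weight nu)

weight-body< : ∀ a (nt : NF t) (nU : NF U) → weight nt < weight (cons a nt nU)
weight-body< _ nt nU = s≤s (m≤m+n (weight nt) (weight nU))

weight-drop-second< : ∀ a b (nt : NF t) (nu : NF u) (nU : NF U) →
                      weight (cons a nt nU) < weight (cons a nt (cons b nu nU))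
weight-drop-second< _ _ nt nu nU = +-monoʳ-< (suc (weight nt)) (s≤s (m≤n+m (weight nU) (weight nu)))

weight-drop-first< : ∀ a b (nt : NF t) (nu : NF u) (nU : NF U) →
                     weight (cons b nu nU) < weight (cons a nt (cons b nu nU))
weight-drop-first< _ b _ nu nU = m<n+m (weight (cons b nu nU)) z<s

module Normalisation (k : Sem) where
  open module Equationalₖ {A : Set} = Equational {A} k

  HasNF : Term A → Set
  HasNF p = ∃[ r ] NF r × 𝓔 k ⊢ p ≈ r

  HasNF-≈ : 𝓔 k ⊢ p ≈ q → HasNF q → HasNF p
  HasNF-≈ e (r , nr , e′) = r , nr , trans e e′

  ⊕-NF : NF p → NF q → HasNF (p ⊕ q)
  ⊕-NF nil nq = _ , nq , ⊕-identityˡ _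
  ⊕-NF (cons a nt nu) nq with ⊕-NF nu nq
  ... | r , nr , e = _ , cons a nt nr , trans (⊕-assoc _ _ _) (ctx⊕ refl e)

  ⊕-HasNF : HasNF p → HasNF q → HasNF (p ⊕ q)
  ⊕-HasNF (_ , np , e) (_ , nq , e′) = HasNF-≈ (ctx⊕ e e′) (⊕-NF np nq)

  ∙-HasNF : ∀ a → HasNF p → HasNF (a ∙ p)
  ∙-HasNF a (_ , np , e) = _ , cons a np nil , trans (ctx∙ a e) (sym (⊕-identityʳ _))

  expand-single-single :
    𝓔 k ⊢ ((a ∙ t ⊕ 𝟎) ∥ (b ∙ u ⊕ 𝟎)) ≈ (a ∙ (t ∥ (b ∙ u ⊕ 𝟎)) ⊕ b ∙ ((a ∙ t ⊕ 𝟎) ∥ u))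
  expand-single-single {a = a} {t = t} {b = b} {u = u} = begin
    (a ∙ t ⊕ 𝟎) ∥ (b ∙ u ⊕ 𝟎)                       ≈⟨ ctx∥ (⊕-identityʳ _) (⊕-identityʳ _) ⟩
    a ∙ t ∥ b ∙ u                                   ≈⟨ EL1-law k ⟩
    a ∙ (t ∥ b ∙ u) ⊕ b ∙ (a ∙ t ∥ u)               ≈⟨ ctx⊕ (ctx∙ a (ctx∥ refl (⊕-identityʳ _)))
                                                            (ctx∙ b (ctx∥ (⊕-identityʳ _) refl)) ⟨
    a ∙ (t ∥ (b ∙ u ⊕ 𝟎)) ⊕ b ∙ ((a ∙ t ⊕ 𝟎) ∥ u)   ∎

  expand-single-many :
    𝓔 k ⊢ ((a ∙ t ⊕ 𝟎) ∥ (b ∙ u ⊕ (c ∙ w ⊕ V)))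
        ≈ (a ∙ (t ∥ (b ∙ u ⊕ (c ∙ w ⊕ V))) ⊕ (a ∙ t ⊕ 𝟎) ∥ (b ∙ u ⊕ V) ⊕ (a ∙ t ⊕ 𝟎) ∥ (c ∙ w ⊕ V))
  expand-single-many {a = a} {t = t} {b = b} {u = u} {c = c} {w = w} {V = V} = begin
    (a ∙ t ⊕ 𝟎) ∥ Q                                         ≈⟨ ctx∥ (⊕-identityʳ _) (sym (⊕-assoc _ _ _)) ⟩
    a ∙ t ∥ (b ∙ u ⊕ c ∙ w ⊕ V)                             ≈⟨ CSP2-law k ⟩
    a ∙ (t ∥ (b ∙ u ⊕ c ∙ w ⊕ V)) ⊕ a ∙ t ∥ Q₁ ⊕ a ∙ t ∥ Q₂ ≈⟨ ctx⊕ (ctx⊕ (ctx∙ a (ctx∥ refl (⊕-assoc _ _ _))) single)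
                                                                     single ⟩
    a ∙ (t ∥ Q) ⊕ (a ∙ t ⊕ 𝟎) ∥ Q₁ ⊕ (a ∙ t ⊕ 𝟎) ∥ Q₂       ∎
    where
    Q  = b ∙ u ⊕ (c ∙ w ⊕ V)
    Q₁ = b ∙ u ⊕ V
    Q₂ = c ∙ w ⊕ V
    single : ∀ {r} → 𝓔 k ⊢ (a ∙ t ∥ r) ≈ ((a ∙ t ⊕ 𝟎) ∥ r)
    single = ctx∥ (sym (⊕-identityʳ _)) refl

  expand-many-single :
    𝓔 k ⊢ ((a ∙ t ⊕ (b ∙ u ⊕ U)) ∥ (c ∙ w ⊕ 𝟎))
        ≈ (c ∙ ((a ∙ t ⊕ (b ∙ u ⊕ U)) ∥ w) ⊕ (a ∙ t ⊕ U) ∥ (c ∙ w ⊕ 𝟎) ⊕ (b ∙ u ⊕ U) ∥ (c ∙ w ⊕ 𝟎))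
  expand-many-single {a = a} {t = t} {b = b} {u = u} {U = U} {c = c} {w = w} = begin
    P ∥ Q                                  ≈⟨ ∥-comm _ _ ⟩
    Q ∥ P                                  ≈⟨ expand-single-many ⟩
    c ∙ (w ∥ P) ⊕ Q ∥ P₁ ⊕ Q ∥ P₂          ≈⟨ ctx⊕ (ctx⊕ (ctx∙ c (∥-comm _ _)) (∥-comm _ _)) (∥-comm _ _) ⟩
    c ∙ (P ∥ w) ⊕ P₁ ∥ Q ⊕ P₂ ∥ Q          ∎
    where
    P  = a ∙ t ⊕ (b ∙ u ⊕ U)
    P₁ = a ∙ t ⊕ U
    P₂ = b ∙ u ⊕ U
    Q  = c ∙ w ⊕ 𝟎

  expand-many-many :
    𝓔 k ⊢ ((a ∙ t ⊕ (b ∙ u ⊕ U)) ∥ (c ∙ w ⊕ (d ∙ v ⊕ V)))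
        ≈ ((a ∙ t ⊕ U) ∥ (c ∙ w ⊕ (d ∙ v ⊕ V)) ⊕ (b ∙ u ⊕ U) ∥ (c ∙ w ⊕ (d ∙ v ⊕ V))
           ⊕ (a ∙ t ⊕ (b ∙ u ⊕ U)) ∥ (c ∙ w ⊕ V) ⊕ (a ∙ t ⊕ (b ∙ u ⊕ U)) ∥ (d ∙ v ⊕ V))
  expand-many-many {a = a} {t = t} {b = b} {u = u} {U = U} {c = c} {w = w} {d = d} {v = v} {V = V} = begin
    P ∥ Q                                  ≈⟨ ctx∥ (⊕-assoc _ _ _) (⊕-assoc _ _ _) ⟨
    P′ ∥ Q′                                ≈⟨ CSP1-law k ⟩
    P₁ ∥ Q′ ⊕ P₂ ∥ Q′ ⊕ P′ ∥ Q₁ ⊕ P′ ∥ Q₂  ≈⟨ ctx⊕ (ctx⊕ (ctx⊕ (ctx∥ refl assoc) (ctx∥ refl assoc))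
                                                         (ctx∥ assoc refl)) (ctx∥ assoc refl) ⟩
    P₁ ∥ Q ⊕ P₂ ∥ Q ⊕ P ∥ Q₁ ⊕ P ∥ Q₂      ∎
    where
    P  = a ∙ t ⊕ (b ∙ u ⊕ U)
    P′ = a ∙ t ⊕ b ∙ u ⊕ U
    P₁ = a ∙ t ⊕ U
    P₂ = b ∙ u ⊕ U
    Q  = c ∙ w ⊕ (d ∙ v ⊕ V)
    Q′ = c ∙ w ⊕ d ∙ v ⊕ V
    Q₁ = c ∙ w ⊕ V
    Q₂ = d ∙ v ⊕ V
    assoc : ∀ {x y z} → 𝓔 k ⊢ ((x ⊕ y) ⊕ z) ≈ (x ⊕ (y ⊕ z))
    assoc = ⊕-assoc _ _ _

  ∥-NF-acc : (np : NF p) (nq : NF q) → Acc _<_ (weight np + weight nq) → HasNF (p ∥ q)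
  ∥-NF-acc nil nq _ = _ , nq , trans (∥-comm _ _) (∥-identityʳ _)
  ∥-NF-acc np@(cons _ _ _) nil _ = _ , np , ∥-identityʳ _
  ∥-NF-acc np@(cons a nt nil) nq@(cons b nu nil) (acc rec) =
    HasNF-≈ expand-single-single
      (⊕-HasNF (∙-HasNF a (∥-NF-acc nt nq (rec (+-monoˡ-< (weight nq) (weight-body< a nt nil)))))
               (∙-HasNF b (∥-NF-acc np nu (rec (+-monoʳ-< (weight np) (weight-body< b nu nil))))))
  ∥-NF-acc np@(cons a nt nil) nq@(cons b nu (cons c nw nV)) (acc rec) =
    HasNF-≈ expand-single-many
      (⊕-HasNF
        (⊕-HasNF
          (∙-HasNF a (∥-NF-acc nt nq (rec (+-monoˡ-< (weight nq) (weight-body< a nt nil)))))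
          (∥-NF-acc np (cons b nu nV) (rec (+-monoʳ-< (weight np) (weight-drop-second< b c nu nw nV)))))
        (∥-NF-acc np (cons c nw nV) (rec (+-monoʳ-< (weight np) (weight-drop-first< b c nu nw nV)))))
  ∥-NF-acc np@(cons a nt (cons b nu nU)) nq@(cons c nw nil) (acc rec) =
    HasNF-≈ expand-many-single
      (⊕-HasNF
        (⊕-HasNF
          (∙-HasNF c (∥-NF-acc np nw (rec (+-monoʳ-< (weight np) (weight-body< c nw nil)))))
          (∥-NF-acc (cons a nt nU) nq (rec (+-monoˡ-< (weight nq) (weight-drop-second< a b nt nu nU)))))
        (∥-NF-acc (cons b nu nU) nq (rec (+-monoˡ-< (weight nq) (weight-drop-first< a b nt nu nU)))))
  ∥-NF-acc np@(cons a nt (cons b nu nU)) nq@(cons c nw (cons d nv nV)) (acc rec) =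
    HasNF-≈ expand-many-many
      (⊕-HasNF
        (⊕-HasNF
          (⊕-HasNF
            (∥-NF-acc (cons a nt nU) nq (rec (+-monoˡ-< (weight nq) (weight-drop-second< a b nt nu nU))))
            (∥-NF-acc (cons b nu nU) nq (rec (+-monoˡ-< (weight nq) (weight-drop-first< a b nt nu nU)))))
          (∥-NF-acc np (cons c nw nV) (rec (+-monoʳ-< (weight np) (weight-drop-second< c d nw nv nV)))))
        (∥-NF-acc np (cons d nv nV) (rec (+-monoʳ-< (weight np) (weight-drop-first< c d nw nv nV)))))

  ∥-HasNF : HasNF p → HasNF q → HasNF (p ∥ q)
  ∥-HasNF (_ , np , e) (_ , nq , e′) = HasNF-≈ (ctx∥ e e′) (∥-NF-acc np nq (<-wellFounded _))

  Closed⇒HasNF : Closed p → HasNF p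
  Closed⇒HasNF c𝟎           = 𝟎 , nil , refl
  Closed⇒HasNF (c∙ {a} cp)  = ∙-HasNF a (Closed⇒HasNF cp)
  Closed⇒HasNF (c⊕ cp cq)   = ⊕-HasNF (Closed⇒HasNF cp) (Closed⇒HasNF cq)
  Closed⇒HasNF (c∥ cp cq)   = ∥-HasNF (Closed⇒HasNF cp) (Closed⇒HasNF cq)

  summand-≼ : NF q → q ─[ a ]→ q′ → a ∙ q′ ≼[ k ] q
  summand-≼ (cons _ _ _)  (sumˡ pre) = ≼-upperˡ _ _
  summand-≼ (cons _ _ nu) (sumʳ t)   = ≼-trans (summand-≼ nu t) (≼-upperʳ _ _)

  transfer⇒≼ : NF p → NF q → Transfer _≲[ k ]_ p q → p ≼[ k ] q
  transfer⇒≼ nil _ _ = 𝟎≼ _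
  transfer⇒≼ (cons a nt nu) nq f with f (sumˡ pre)
  ... | q′ , t , s =
    ≼-lub (≼-trans (∙-mono-≼ k a nt nq′ (≲-completion s) (transfer⇒≼ nt nq′ (≲-transfer s)))
                   (summand-≼ nq t))
          (transfer⇒≼ nu nq (f ∘ sumʳ))
    where
    nq′ : NF q′
    nq′ = NF-step nq t

  ≃⇒≈-NF : NF p → NF q → p ≃[ k ] q → 𝓔 k ⊢ p ≈ q
  ≃⇒≈-NF np nq (s , s′) = ≼-antisym (transfer⇒≼ np nq (≲-transfer s)) (transfer⇒≼ nq np (≲-transfer s′))

  complete : Closed p → Closed q → p ≃[ k ] q → 𝓔 k ⊢ p ≈ q
  complete {p = p} {q = q} cp cq p≃q with Closed⇒HasNF cp | Closed⇒HasNF cq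
  ... | p̂ , np , p≈p̂ | q̂ , nq , q≈q̂ = begin
    p  ≈⟨ p≈p̂ ⟩
    p̂  ≈⟨ ≃⇒≈-NF np nq (≃-trans (≃-sym (sound k p≈p̂)) (≃-trans p≃q (sound k q≈q̂))) ⟩
    q̂  ≈⟨ q≈q̂ ⟨
    q  ∎

theorem4p6 : (n : ℕ) (X : Sem) (p q : Term (Fin (suc n))) →
             Closed p → Closed q →
             (p ∼[ X ] q) ⇔ (𝓔 X ⊢ p ≈ q)
theorem4p6 n X p q cp cq =
  mk⇔ (complete cp cq ∘ Equivalence.to (∼⇔≃ X))
      (Equivalence.from (∼⇔≃ X) ∘ sound X)
  where open Normalisation X
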